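{- For a positive integer $v$ (with $v\geq 3$), there exists a DTS$(v)$ having a $v$-good sequencing if and only if $v \equiv 0,1 \pmod 3$.
   Context: A transitive triple is an ordered triple $(x,y,z)$ of distinct elements; it contains the directed edges $(x,y)$, $(x,z)$, $(y,z)$. A directed triple system of order $v$, DTS$(v)$, is a pair $(X,\mathcal{B})$ where $X$ is a set of $v$ points and $\mathcal{B}$ is a set of transitive triples of elements of $X$ such that every ordered pair $(a,b)$ of distinct points of $X$ occurs as a directed edge in exactly one triple of $\mathcal{B}$. A $v$-good sequencing of a DTS$(v)$ $(X,\mathcal{B})$ is a permutation $[x_1\, x_2\, \cdots\, x_v]$ of $X$ such that for no triple $(x,y,z)\in\mathcal{B}$ do we have $x=x_i$, $y=x_j$, $z=x_k$ with $i<j<k$. -}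

module Defs where

open import Data.Nat using (ℕ)
open import Data.Fin using (Fin; _<_)
open import Data.Product using (Σ; _×_; _,_; ∃)
open import Data.Sum using (_⊎_)
open import Relation.Binary.PropositionalEquality using (_≡_; _≢_)
open import Relation.Nullary using (¬_)
open import Function.Bundles using (_↔_; Inverse)

record TransitiveTriple (v : ℕ) : Set where
  constructor tt
  field
    fst snd thd : Fin v
    x≢y : fst ≢ snd
    x≢z : fst ≢ thd
    y≢z : snd ≢ thd
open TransitiveTriple public

HasEdge : ∀ {v} → TransitiveTriple v → Fin v → Fin v → Set
HasEdge t a b =
  (a ≡ fst t × b ≡ snd t) ⊎ (a ≡ fst t × b ≡ thd t) ⊎ (a ≡ snd t × b ≡ thd t)

SameTriple : ∀ {v} → TransitiveTriple v → TransitiveTriple v → Set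
SameTriple s t = fst s ≡ fst t × snd s ≡ snd t × thd s ≡ thd t

record DTS (v : ℕ) : Set where
  field
    nBlocks : ℕ
    block   : Fin nBlocks → TransitiveTriple v
    distinct-blocks : ∀ i j → SameTriple (block i) (block j) → i ≡ j
    covered : ∀ (a b : Fin v) → a ≢ b → ∃ λ i → HasEdge (block i) a b
    unique  : ∀ (a b : Fin v) (i j : Fin nBlocks) →
              HasEdge (block i) a b → HasEdge (block j) a b → i ≡ j
open DTS public

-- A v-good sequencing: a permutation [x_1 ... x_v] of X, given as a bijection
-- seq : Fin v ↔ Fin v (position ↦ point), such that no block (x , y , z)
-- has x = x_i, y = x_j, z = x_k with i < j < k.
GoodSequencing : ∀ {v} → DTS v → Set
GoodSequencing {v} D =
  Σ (Fin v ↔ Fin v) λ seq →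
    let open Inverse seq in
    ∀ (blk : Fin (nBlocks D)) (i j k : Fin v) →
      to i ≡ fst (block D blk) → to j ≡ snd (block D blk) → to k ≡ thd (block D blk) →
      ¬ (i < j × j < k)

-- A DTS(v) has v(v − 1)/3 blocks, since the pairs (block, edge of the block) correspond
-- bijectively to the ordered pairs of distinct points; hence v ≢ 2 (mod 3).
--
-- Conversely, suppose the natural order of {0, …, w − 1} is a good sequencing of a DTS(w),
-- and let n = w + 1 or n = w + 4. On ℤₙ ⊎ {0, …, w − 1} take the old blocks, the blocks
-- (x, d, x + d + 1) for x ∈ ℤₙ and d < w, which cover all edges between ℤₙ and the old
-- points and all edges of ℤₙ of difference 1, …, w, and, when n = w + 4, the blocks
-- (x, x − 1, x − 3), which cover the differences w + 1, w + 2, w + 3. Listing 0, …, n − 1 in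
-- ℤₙ before the old points is again a good sequencing: a block (x, d, x + d + 1) steps back
-- from the old point d to ℤₙ, and in (x, x − 1, x − 3) we have x < x − 1 only for x = 0,
-- when x − 1 = n − 1 > n − 3 = x − 3.
-- Starting from v = 0 and v = 1, the steps v ↦ 2v + 1 and v ↦ 2v + 4 reach every
-- v ≡ 0, 1 (mod 3).

module Submission where

open import Level using (0ℓ)
open import Data.Empty using (⊥; ⊥-elim)
open import Data.Fin as Fin using (Fin; zero; suc; toℕ; fromℕ<; join; punchIn; punchOut)
open import Data.Fin.Properties
  using (toℕ-injective; toℕ-fromℕ<; toℕ<n; toℕ-↑ˡ; toℕ-↑ʳ; +↔⊎; *↔×; 0↔⊥;
         punchIn-injective; punchInᵢ≢i; punchOut-injective; cantor-schröder-bernstein)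
open import Data.Nat
  using (ℕ; zero; suc; _+_; _*_; _∸_; _≤_; _<_; _≥_; _%_; _/_; NonZero; >-nonZero⁻¹; s≤s; z<s; _<?_)
open import Data.Nat.DivMod
open import Data.Nat.Divisibility using (divides; n∣m⇒m%n≡0)
open import Data.Nat.Induction using (<-rec)
open import Data.Nat.Primality using (prime?; euclidsLemma)
open import Data.Nat.Properties
open import Data.Nat.Tactic.RingSolver using (solve-∀)
open import Data.Product using (Σ; ∃; _×_; _,_; proj₁; proj₂; uncurry)
open import Data.Sum using (_⊎_; inj₁; inj₂; [_,_])
open import Data.Sum.Function.Propositional using (_⊎-↔_)
open import Data.Sum.Properties using (inj₁-injective; inj₂-injective)
open import Data.Sum.Relation.Binary.LeftOrder using (_⊎-<_; ₁∼₂; ₁∼₁; ₂∼₂; drop-inj₁; drop-inj₂)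
open import Function using (_∘_)
open import Function.Bundles using (_↔_; _⇔_; Inverse; Injection; mk⇔)
open import Function.Construct.Composition using (_↔-∘_)
open import Function.Construct.Identity using (↔-id)
open import Function.Construct.Symmetry using (↔-sym)
open import Function.Definitions using (Injective)
open import Function.Properties.Inverse using (↔⇒↣)
open import Relation.Binary.Core using (Rel; _⇒_)
open import Relation.Binary.Construct.Union using (_∪_)
open import Relation.Binary.PropositionalEquality
  using (_≡_; _≢_; refl; sym; trans; cong; subst; subst₂; module ≡-Reasoning)
open import Relation.Nullary using (¬_; yes; no)
open import Relation.Nullary.Decidable using (from-yes)

open import Defs

open ≡-Reasoning

↔-injective : ∀ {A B : Set} (φ : A ↔ B) → Injective _≡_ _≡_ (Inverse.to φ)
↔-injective φ = Injection.injective (↔⇒↣ φ)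

-- Decompositions of a digraph into transitive triples

record Triple (X : Set) : Set where
  constructor ⟨_,_,_⟩
  field
    fst snd thd : X
open Triple

map₃ : ∀ {X Y : Set} → (X → Y) → Triple X → Triple Y
map₃ f ⟨ x , y , z ⟩ = ⟨ f x , f y , f z ⟩

data Edge {X : Set} (t : Triple X) (a b : X) : Set where
  xy : a ≡ fst t → b ≡ snd t → Edge t a b
  xz : a ≡ fst t → b ≡ thd t → Edge t a b
  yz : a ≡ snd t → b ≡ thd t → Edge t a b

Edge-map : ∀ {X Y : Set} (f : X → Y) {t a b} → Edge t a b → Edge (map₃ f t) (f a) (f b)
Edge-map f (xy refl refl) = xy refl refl
Edge-map f (xz refl refl) = xz refl refl
Edge-map f (yz refl refl) = yz refl refl

Edge-map⁻¹ : ∀ {X Y : Set} {f : X → Y} → Injective _≡_ _≡_ f →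
             ∀ {t a b} → Edge (map₃ f t) (f a) (f b) → Edge t a b
Edge-map⁻¹ f-inj (xy p q) = xy (f-inj p) (f-inj q)
Edge-map⁻¹ f-inj (xz p q) = xz (f-inj p) (f-inj q)
Edge-map⁻¹ f-inj (yz p q) = yz (f-inj p) (f-inj q)

-- A decomposition of the digraph E into transitive triples; a DTS is the case E = _≢_.
record TripleSystem {X : Set} (E : Rel X 0ℓ) : Set₁ where
  field
    Block       : Set
    size        : ℕ
    enumeration : Block ↔ Fin size
    block       : Block → Triple X
    sound       : ∀ i {a b} → Edge (block i) a b → E a b
    covered     : ∀ {a b} → E a b → ∃ λ i → Edge (block i) a b
    unique      : ∀ {i j a b} → Edge (block i) a b → Edge (block j) a b → i ≡ j
open TripleSystem

Ascending : ∀ {X : Set} → Rel X 0ℓ → Triple X → Set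
Ascending _≺_ t = fst t ≺ snd t × snd t ≺ thd t

NoAscendingBlock : ∀ {X : Set} {E : Rel X 0ℓ} → Rel X 0ℓ → TripleSystem E → Set
NoAscendingBlock _≺_ S = ∀ i → ¬ Ascending _≺_ (block S i)

record SequencedSystem {X : Set} (_≺_ E : Rel X 0ℓ) : Set₁ where
  constructor _↗_
  field
    system      : TripleSystem E
    noAscending : NoAscendingBlock _≺_ system

data Image {X Y : Set} (f : X → Y) (E : Rel X 0ℓ) : Rel Y 0ℓ where
  image : ∀ {a b} → E a b → Image f E (f a) (f b)

module _ {X : Set} {_≺_ : Rel X 0ℓ} where

  noBlocks : {E : Rel X 0ℓ} → (∀ {a b} → ¬ E a b) → SequencedSystem _≺_ E
  noBlocks ¬E = record
    { Block = ⊥ ; size = 0 ; enumeration = ↔-sym 0↔⊥ ; block = λ ()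
    ; sound = λ () ; covered = ⊥-elim ∘ ¬E ; unique = λ {i} → ⊥-elim i }
    ↗ λ ()

  castEdges : {E F : Rel X 0ℓ} → E ⇒ F → F ⇒ E → SequencedSystem _≺_ E → SequencedSystem _≺_ F
  castEdges E⇒F F⇒E (S ↗ S↗) = record
    { Block = Block S ; size = size S ; enumeration = enumeration S ; block = block S
    ; sound = λ i → E⇒F ∘ sound S i ; covered = covered S ∘ F⇒E ; unique = unique S }
    ↗ S↗

  union : {E F : Rel X 0ℓ} → (∀ {a b} → E a b → F a b → ⊥) →
          SequencedSystem _≺_ E → SequencedSystem _≺_ F → SequencedSystem _≺_ (E ∪ F)
  union {E} {F} disjoint (S ↗ S↗) (T ↗ T↗) = record
    { Block       = Block S ⊎ Block T
    ; size        = size S + size T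
    ; enumeration = ↔-sym +↔⊎ ↔-∘ (enumeration S ⊎-↔ enumeration T)
    ; block       = block′
    ; sound       = λ { (inj₁ i) → inj₁ ∘ sound S i ; (inj₂ j) → inj₂ ∘ sound T j }
    ; covered     = covered′
    ; unique      = unique′ }
    ↗ λ { (inj₁ i) → S↗ i ; (inj₂ j) → T↗ j }
    where
    block′ : Block S ⊎ Block T → Triple X
    block′ = [ block S , block T ]
    covered′ : ∀ {a b} → (E ∪ F) a b → ∃ λ i → Edge (block′ i) a b
    covered′ (inj₁ e) = let i , h = covered S e in inj₁ i , h
    covered′ (inj₂ f) = let j , h = covered T f in inj₂ j , h
    unique′ : ∀ {i j a b} → Edge (block′ i) a b → Edge (block′ j) a b → i ≡ j
    unique′ {inj₁ i} {inj₁ j} h h′ = cong inj₁ (unique S h h′)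
    unique′ {inj₁ i} {inj₂ j} h h′ = ⊥-elim (disjoint (sound S i h) (sound T j h′))
    unique′ {inj₂ i} {inj₁ j} h h′ = ⊥-elim (disjoint (sound S j h′) (sound T i h))
    unique′ {inj₂ i} {inj₂ j} h h′ = cong inj₂ (unique T h h′)

module _ {X Y : Set} {_≺_ : Rel X 0ℓ} {_≺′_ : Rel Y 0ℓ} {f : X → Y} (f-inj : Injective _≡_ _≡_ f) where

  embed : {E : Rel X 0ℓ} → (∀ {a b} → f a ≺′ f b → a ≺ b) →
          SequencedSystem _≺_ E → SequencedSystem _≺′_ (Image f E)
  embed {E} reflects (S ↗ S↗) = record
    { Block = Block S ; size = size S ; enumeration = enumeration S
    ; block = map₃ f ∘ block S ; sound = sound′
    ; covered = λ { (image e) → let i , h = covered S e in i , Edge-map f h }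
    ; unique = unique′ }
    ↗ λ i (p , q) → S↗ i (reflects p , reflects q)
    where
    sound′ : ∀ i {a b} → Edge (map₃ f (block S i)) a b → Image f E a b
    sound′ i (xy refl refl) = image (sound S i (xy refl refl))
    sound′ i (xz refl refl) = image (sound S i (xz refl refl))
    sound′ i (yz refl refl) = image (sound S i (yz refl refl))
    unique′ : ∀ {i j a b} → Edge (map₃ f (block S i)) a b → Edge (map₃ f (block S j)) a b → i ≡ j
    unique′ h@(xy refl refl) h′ = unique S (Edge-map⁻¹ f-inj h) (Edge-map⁻¹ f-inj h′)
    unique′ h@(xz refl refl) h′ = unique S (Edge-map⁻¹ f-inj h) (Edge-map⁻¹ f-inj h′)
    unique′ h@(yz refl refl) h′ = unique S (Edge-map⁻¹ f-inj h) (Edge-map⁻¹ f-inj h′)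

transport : ∀ {X Y : Set} {_≺_ : Rel X 0ℓ} {_≺′_ : Rel Y 0ℓ} (φ : X ↔ Y) →
            (∀ {a b} → Inverse.to φ a ≺′ Inverse.to φ b → a ≺ b) →
            SequencedSystem _≺_ (_≢_ {A = X}) → SequencedSystem _≺′_ (_≢_ {A = Y})
transport φ reflects = castEdges image⇒≢ ≢⇒image ∘ embed (↔-injective φ) reflects
  where
  open Inverse φ
  image⇒≢ : Image to _≢_ ⇒ _≢_
  image⇒≢ (image a≢b) = a≢b ∘ ↔-injective φ
  ≢⇒image : _≢_ ⇒ Image to _≢_
  ≢⇒image {a} {b} a≢b =
    subst₂ (Image to _≢_) (strictlyInverseˡ a) (strictlyInverseˡ b)
      (image λ eq → a≢b (trans (sym (strictlyInverseˡ a)) (trans (cong to eq) (strictlyInverseˡ b))))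

-- A DTS(v) for which listing the points in their natural order is a v-good sequencing.
SequencedDTS : ℕ → Set₁
SequencedDTS v = SequencedSystem Fin._<_ (_≢_ {A = Fin v})

module _ {v : ℕ} (S : TripleSystem (_≢_ {A = Fin v})) where
  open Inverse (enumeration S) using (to; from; strictlyInverseʳ)

  transitiveBlock : Fin (size S) → TransitiveTriple v
  transitiveBlock k =
    tt (fst t) (snd t) (thd t) (sound S i (xy refl refl)) (sound S i (xz refl refl)) (sound S i (yz refl refl))
    where
    i = from k
    t = block S i

  HasEdge⇒Edge : ∀ {k a b} → HasEdge (transitiveBlock k) a b → Edge (block S (from k)) a b
  HasEdge⇒Edge (inj₁ (p , q))        = xy p q
  HasEdge⇒Edge (inj₂ (inj₁ (p , q))) = xz p q
  HasEdge⇒Edge (inj₂ (inj₂ (p , q))) = yz p q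

  Edge⇒HasEdge : ∀ {k a b} → Edge (block S (from k)) a b → HasEdge (transitiveBlock k) a b
  Edge⇒HasEdge (xy p q) = inj₁ (p , q)
  Edge⇒HasEdge (xz p q) = inj₂ (inj₁ (p , q))
  Edge⇒HasEdge (yz p q) = inj₂ (inj₂ (p , q))

  covered-transitive : ∀ {a b} → a ≢ b → ∃ λ k → HasEdge (transitiveBlock k) a b
  covered-transitive a≢b =
    let i , h = covered S a≢b
    in to i , Edge⇒HasEdge (subst (λ j → Edge (block S j) _ _) (sym (strictlyInverseʳ i)) h)

  unique-transitive : ∀ {a b} k l → HasEdge (transitiveBlock k) a b → HasEdge (transitiveBlock l) a b → k ≡ l
  unique-transitive k l h h′ =
    ↔-injective (↔-sym (enumeration S)) (unique S (HasEdge⇒Edge {k} h) (HasEdge⇒Edge {l} h′))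

  toDTS : DTS v
  toDTS = record
    { nBlocks         = size S
    ; block           = transitiveBlock
    ; distinct-blocks = λ k l (p , q , _) → unique-transitive k l (inj₁ (refl , refl)) (inj₁ (p , q))
    ; covered         = λ _ _ → covered-transitive
    ; unique          = λ _ _ → unique-transitive }

  identity-isGood : NoAscendingBlock Fin._<_ S → GoodSequencing toDTS
  identity-isGood S↗ = ↔-id (Fin v) , λ { k _ _ _ refl refl refl → S↗ (from k) }

SequencedDTS⇒GoodSequencing : ∀ {v} → SequencedDTS v → Σ (DTS v) GoodSequencing
SequencedDTS⇒GoodSequencing (S ↗ S↗) = toDTS S , identity-isGood S S↗

-- Arithmetic in ℤ/n on Fin n

[m%n+k]%n≡[m+k]%n : ∀ m k n .{{_ : NonZero n}} → (m % n + k) % n ≡ (m + k) % n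
[m%n+k]%n≡[m+k]%n m k n = begin
  (m % n + k) % n          ≡⟨ %-distribˡ-+ (m % n) k n ⟩
  (m % n % n + k % n) % n  ≡⟨ cong (λ r → (r + k % n) % n) (m%n%n≡m%n m n) ⟩
  (m % n + k % n) % n      ≡⟨ %-distribˡ-+ m k n ⟨
  (m + k) % n              ∎

module Cyclic (n : ℕ) .{{_ : NonZero n}} where

  infixl 6 _⊕_ _⊖_

  _⊕_ : Fin n → ℕ → Fin n
  x ⊕ a = (toℕ x + a) mod n

  -- y ⊖ x is the representative of y − x in [0, n).
  _⊖_ : Fin n → Fin n → ℕ
  y ⊖ x = toℕ (y ⊕ (n ∸ toℕ x))

  toℕ-⊕ : ∀ x a → toℕ (x ⊕ a) ≡ (toℕ x + a) % n
  toℕ-⊕ x a = toℕ-fromℕ< (m%n<n (toℕ x + a) n)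

  ⊕-assoc : ∀ x a b → x ⊕ a ⊕ b ≡ x ⊕ (a + b)
  ⊕-assoc x a b = toℕ-injective (begin
    toℕ (x ⊕ a ⊕ b)            ≡⟨ toℕ-⊕ (x ⊕ a) b ⟩
    (toℕ (x ⊕ a) + b) % n      ≡⟨ cong (λ r → (r + b) % n) (toℕ-⊕ x a) ⟩
    ((toℕ x + a) % n + b) % n  ≡⟨ [m%n+k]%n≡[m+k]%n (toℕ x + a) b n ⟩
    (toℕ x + a + b) % n        ≡⟨ cong (_% n) (+-assoc (toℕ x) a b) ⟩
    (toℕ x + (a + b)) % n      ≡⟨ toℕ-⊕ x (a + b) ⟨
    toℕ (x ⊕ (a + b))          ∎)

  ⊕-comm-toℕ : ∀ x y → x ⊕ toℕ y ≡ y ⊕ toℕ x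
  ⊕-comm-toℕ x y = toℕ-injective (begin
    toℕ (x ⊕ toℕ y)          ≡⟨ toℕ-⊕ x (toℕ y) ⟩
    (toℕ x + toℕ y) % n      ≡⟨ cong (_% n) (+-comm (toℕ x) (toℕ y)) ⟩
    (toℕ y + toℕ x) % n      ≡⟨ toℕ-⊕ y (toℕ x) ⟨
    toℕ (y ⊕ toℕ x)          ∎)

  ⊕-identityʳ : ∀ x → x ⊕ 0 ≡ x
  ⊕-identityʳ x = toℕ-injective (begin
    toℕ (x ⊕ 0)          ≡⟨ toℕ-⊕ x 0 ⟩
    (toℕ x + 0) % n      ≡⟨ cong (_% n) (+-identityʳ (toℕ x)) ⟩
    toℕ x % n            ≡⟨ m<n⇒m%n≡m (toℕ<n x) ⟩
    toℕ x                ∎)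

  ⊕-period : ∀ x → x ⊕ n ≡ x
  ⊕-period x = toℕ-injective (begin
    toℕ (x ⊕ n)          ≡⟨ toℕ-⊕ x n ⟩
    (toℕ x + n) % n      ≡⟨ [m+n]%n≡m%n (toℕ x) n ⟩
    toℕ x % n            ≡⟨ m<n⇒m%n≡m (toℕ<n x) ⟩
    toℕ x                ∎)

  ⊕-∸-⊕ : ∀ x {a} → a ≤ n → x ⊕ (n ∸ a) ⊕ a ≡ x
  ⊕-∸-⊕ x {a} a≤n = begin
    x ⊕ (n ∸ a) ⊕ a   ≡⟨ ⊕-assoc x (n ∸ a) a ⟩
    x ⊕ (n ∸ a + a)   ≡⟨ cong (x ⊕_) (m∸n+n≡m a≤n) ⟩
    x ⊕ n             ≡⟨ ⊕-period x ⟩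
    x                 ∎

  ⊕-⊕-∸ : ∀ x {a} → a ≤ n → x ⊕ a ⊕ (n ∸ a) ≡ x
  ⊕-⊕-∸ x {a} a≤n = begin
    x ⊕ a ⊕ (n ∸ a)   ≡⟨ ⊕-assoc x a (n ∸ a) ⟩
    x ⊕ (a + (n ∸ a)) ≡⟨ cong (x ⊕_) (m+[n∸m]≡n a≤n) ⟩
    x ⊕ n             ≡⟨ ⊕-period x ⟩
    x                 ∎

  ⊕-cancelʳ : ∀ {x y a} → a ≤ n → x ⊕ a ≡ y ⊕ a → x ≡ y
  ⊕-cancelʳ {x} {y} {a} a≤n eq = begin
    x                 ≡⟨ ⊕-⊕-∸ x a≤n ⟨
    x ⊕ a ⊕ (n ∸ a)   ≡⟨ cong (_⊕ (n ∸ a)) eq ⟩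
    y ⊕ a ⊕ (n ∸ a)   ≡⟨ ⊕-⊕-∸ y a≤n ⟩
    y                 ∎

  ⊖<n : ∀ y x → y ⊖ x < n
  ⊖<n y x = toℕ<n (y ⊕ (n ∸ toℕ x))

  ⊕-⊖ : ∀ x y → x ⊕ (y ⊖ x) ≡ y
  ⊕-⊖ x y = begin
    x ⊕ toℕ (y ⊕ (n ∸ toℕ x))  ≡⟨ ⊕-comm-toℕ x (y ⊕ (n ∸ toℕ x)) ⟩
    y ⊕ (n ∸ toℕ x) ⊕ toℕ x    ≡⟨ ⊕-∸-⊕ y (<⇒≤ (toℕ<n x)) ⟩
    y                          ∎

  ⊖-⊕ : ∀ x {a} → a < n → (x ⊕ a) ⊖ x ≡ a
  ⊖-⊕ x {a} a<n = begin
    toℕ (x ⊕ a ⊕ (n ∸ toℕ x))   ≡⟨ toℕ-⊕ (x ⊕ a) (n ∸ toℕ x) ⟩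
    (toℕ (x ⊕ a) + (n ∸ toℕ x)) % n ≡⟨ cong (λ r → (r + (n ∸ toℕ x)) % n) (toℕ-⊕ x a) ⟩
    ((toℕ x + a) % n + (n ∸ toℕ x)) % n ≡⟨ [m%n+k]%n≡[m+k]%n (toℕ x + a) (n ∸ toℕ x) n ⟩
    (toℕ x + a + (n ∸ toℕ x)) % n ≡⟨ cong (_% n) (+-assoc (toℕ x) a _) ⟩
    (toℕ x + (a + (n ∸ toℕ x))) % n ≡⟨ cong (λ r → (toℕ x + r) % n) (+-comm a _) ⟩
    (toℕ x + ((n ∸ toℕ x) + a)) % n ≡⟨ cong (_% n) (+-assoc (toℕ x) _ a) ⟨
    (toℕ x + (n ∸ toℕ x) + a) % n ≡⟨ cong (λ r → (r + a) % n) (m+[n∸m]≡n (<⇒≤ (toℕ<n x))) ⟩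
    (n + a) % n                   ≡⟨ cong (_% n) (+-comm n a) ⟩
    (a + n) % n                   ≡⟨ [m+n]%n≡m%n a n ⟩
    a % n                         ≡⟨ m<n⇒m%n≡m a<n ⟩
    a                             ∎

  ⊕-cancelˡ : ∀ x {a b} → a < n → b < n → x ⊕ a ≡ x ⊕ b → a ≡ b
  ⊕-cancelˡ x {a} {b} a<n b<n eq = begin
    a             ≡⟨ ⊖-⊕ x a<n ⟨
    (x ⊕ a) ⊖ x   ≡⟨ cong (_⊖ x) eq ⟩
    (x ⊕ b) ⊖ x   ≡⟨ ⊖-⊕ x b<n ⟩
    b             ∎

  ⊖-self : ∀ x → x ⊖ x ≡ 0
  ⊖-self x = subst (λ y → y ⊖ x ≡ 0) (⊕-identityʳ x) (⊖-⊕ x (>-nonZero⁻¹ n))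

  ⊖≡0⇒≡ : ∀ {x y} → y ⊖ x ≡ 0 → x ≡ y
  ⊖≡0⇒≡ {x} {y} eq = begin
    x             ≡⟨ ⊕-identityʳ x ⟨
    x ⊕ 0         ≡⟨ cong (x ⊕_) eq ⟨
    x ⊕ (y ⊖ x)   ≡⟨ ⊕-⊖ x y ⟩
    y             ∎

  toℕ-⊕-< : ∀ x {a} → toℕ x + a < n → toℕ (x ⊕ a) ≡ toℕ x + a
  toℕ-⊕-< x {a} lt = trans (toℕ-⊕ x a) (m<n⇒m%n≡m lt)

  toℕ-⊕-wrap : ∀ x {a r} → toℕ x + a ≡ n + r → r < n → toℕ (x ⊕ a) ≡ r
  toℕ-⊕-wrap x {a} {r} eq r<n = begin
    toℕ (x ⊕ a)          ≡⟨ toℕ-⊕ x a ⟩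
    (toℕ x + a) % n      ≡⟨ cong (_% n) (trans eq (+-comm n r)) ⟩
    (r + n) % n          ≡⟨ [m+n]%n≡m%n r n ⟩
    r % n                ≡⟨ m<n⇒m%n≡m r<n ⟩
    r                    ∎

-- The doubling construction

join-reflects-< : ∀ {n w} {a b : Fin n ⊎ Fin w} → join n w a Fin.< join n w b → (Fin._<_ ⊎-< Fin._<_) a b
join-reflects-< {n} {w} {inj₁ x} {inj₁ y} lt = ₁∼₁ (subst₂ _<_ (toℕ-↑ˡ x w) (toℕ-↑ˡ y w) lt)
join-reflects-< {n} {w} {inj₁ x} {inj₂ d} lt = ₁∼₂
join-reflects-< {n} {w} {inj₂ d} {inj₁ y} lt =
  ⊥-elim (<-asym (subst₂ _<_ (toℕ-↑ʳ n d) (toℕ-↑ˡ y w) lt) (<-≤-trans (toℕ<n y) (m≤m+n n (toℕ d))))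
join-reflects-< {n} {w} {inj₂ d} {inj₂ e} lt =
  ₂∼₂ (+-cancelˡ-< n (toℕ d) (toℕ e) (subst₂ _<_ (toℕ-↑ʳ n d) (toℕ-↑ʳ n e) lt))

module Doubling (w n : ℕ) .{{_ : NonZero n}} (w<n : w < n) where
  open Cyclic n

  Point : Set
  Point = Fin n ⊎ Fin w

  _≺_ : Rel Point 0ℓ
  _≺_ = Fin._<_ ⊎-< Fin._<_

  Long : Rel (Fin n) 0ℓ
  Long x y = w < y ⊖ x

  data Mixed : Rel Point 0ℓ where
    new→old : ∀ {x} {d : Fin w} → Mixed (inj₁ x) (inj₂ d)
    old→new : ∀ {d : Fin w} {y} → Mixed (inj₂ d) (inj₁ y)
    short   : ∀ {x y} (d : Fin w) → y ⊖ x ≡ suc (toℕ d) → Mixed (inj₁ x) (inj₁ y)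

  1+d<n : ∀ (d : Fin w) → suc (toℕ d) < n
  1+d<n d = <-≤-trans (s≤s (toℕ<n d)) w<n

  mixedBlock : Fin w × Fin n → Triple Point
  mixedBlock (d , x) = ⟨ inj₁ x , inj₂ d , inj₁ (x ⊕ suc (toℕ d)) ⟩

  mixed : SequencedSystem _≺_ Mixed
  mixed = record
    { Block = Fin w × Fin n ; size = w * n ; enumeration = ↔-sym *↔× ; block = mixedBlock
    ; sound = sound′ ; covered = covered′ ; unique = unique′ }
    ↗ λ { _ (_ , ()) }
    where
    sound′ : ∀ i {a b} → Edge (mixedBlock i) a b → Mixed a b
    sound′ (d , x) (xy refl refl) = new→old
    sound′ (d , x) (xz refl refl) = short d (⊖-⊕ x (1+d<n d))
    sound′ (d , x) (yz refl refl) = old→new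
    covered′ : ∀ {a b} → Mixed a b → ∃ λ i → Edge (mixedBlock i) a b
    covered′ (new→old {x} {d}) = (d , x) , xy refl refl
    covered′ (old→new {d} {y}) =
      (d , y ⊕ (n ∸ suc (toℕ d))) , yz refl (cong inj₁ (sym (⊕-∸-⊕ y (<⇒≤ (1+d<n d)))))
    covered′ (short {x} {y} d eq) =
      (d , x) , xz refl (cong inj₁ (trans (sym (⊕-⊖ x y)) (cong (x ⊕_) eq)))
    unique′ : ∀ {i j a b} → Edge (mixedBlock i) a b → Edge (mixedBlock j) a b → i ≡ j
    unique′ {d , x} {_ , _} (xy refl refl) (xy refl refl) = refl
    unique′ {d , x} {e , _} (xz refl refl) (xz refl q) =
      cong (_, x) (toℕ-injective (suc-injective (⊕-cancelˡ x (1+d<n d) (1+d<n e) (inj₁-injective q))))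
    unique′ {d , x} {_ , y} (yz refl refl) (yz refl q) =
      cong (d ,_) (⊕-cancelʳ (<⇒≤ (1+d<n d)) (inj₁-injective q))
    unique′ {_ , _} {_ , _} (xy refl refl) (xz refl ())
    unique′ {_ , _} {_ , _} (xy refl refl) (yz () _)
    unique′ {_ , _} {_ , _} (xz refl refl) (xy refl ())
    unique′ {_ , _} {_ , _} (xz refl refl) (yz () _)
    unique′ {_ , _} {_ , _} (yz refl refl) (xy () _)
    unique′ {_ , _} {_ , _} (yz refl refl) (xz () _)

  LongEdge OldEdge : Rel Point 0ℓ
  LongEdge = Image inj₁ Long
  OldEdge  = Image inj₂ _≢_

  long-old-disjoint : ∀ {a b} → LongEdge a b → OldEdge a b → ⊥
  long-old-disjoint (image _) ()

  mixed-disjoint : ∀ {a b} → Mixed a b → (LongEdge ∪ OldEdge) a b → ⊥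
  mixed-disjoint (short d eq) (inj₁ (image long)) = <⇒≱ (toℕ<n d) (≤-pred (subst (w <_) eq long))
  mixed-disjoint (short _ _)  (inj₂ ())
  mixed-disjoint new→old      (inj₁ ())
  mixed-disjoint new→old      (inj₂ ())
  mixed-disjoint old→new      (inj₁ ())
  mixed-disjoint old→new      (inj₂ ())

  edge⇒≢ : Mixed ∪ (LongEdge ∪ OldEdge) ⇒ _≢_
  edge⇒≢ (inj₁ (short {x} d eq)) refl = 0≢1+n (trans (sym (⊖-self x)) eq)
  edge⇒≢ (inj₂ (inj₁ (image {x} long))) refl = n≮0 (subst (w <_) (⊖-self x) long)
  edge⇒≢ (inj₁ new→old) ()
  edge⇒≢ (inj₁ old→new) ()
  edge⇒≢ (inj₂ (inj₂ (image a≢b))) refl = a≢b refl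

  short-or-long : ∀ {x y} → x ≢ y → Mixed (inj₁ x) (inj₁ y) ⊎ Long x y
  short-or-long {x} {y} x≢y with y ⊖ x in eq
  ... | zero = ⊥-elim (x≢y (⊖≡0⇒≡ eq))
  ... | suc k with k <? w
  ...   | yes k<w = inj₁ (short (fromℕ< k<w) (trans eq (cong suc (sym (toℕ-fromℕ< k<w)))))
  ...   | no k≮w  = inj₂ (s≤s (≮⇒≥ k≮w))

  ≢⇒edge : _≢_ ⇒ Mixed ∪ (LongEdge ∪ OldEdge)
  ≢⇒edge {inj₁ x} {inj₁ y} p with short-or-long (p ∘ cong inj₁)
  ... | inj₁ m = inj₁ m
  ... | inj₂ l = inj₂ (inj₁ (image l))
  ≢⇒edge {inj₁ x} {inj₂ d} _ = inj₁ new→old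
  ≢⇒edge {inj₂ d} {inj₁ y} _ = inj₁ old→new
  ≢⇒edge {inj₂ d} {inj₂ e} p = inj₂ (inj₂ (image (p ∘ cong inj₂)))

  double : SequencedSystem Fin._<_ Long → SequencedDTS w → SequencedDTS (n + w)
  double G S = transport (↔-sym +↔⊎) (λ {a} {b} → join-reflects-< {a = a} {b}) points
    where
    long : SequencedSystem _≺_ LongEdge
    long = embed inj₁-injective drop-inj₁ G
    old : SequencedSystem _≺_ OldEdge
    old = embed inj₂-injective drop-inj₂ S
    points : SequencedSystem _≺_ _≢_
    points = castEdges edge⇒≢ ≢⇒edge (union mixed-disjoint mixed (union long-old-disjoint long old))

double+1 : ∀ {w} → SequencedDTS w → SequencedDTS (suc w + w)
double+1 {w} = double (noBlocks λ {x} {y} long → <⇒≱ (⊖<n y x) long)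
  where
  open Cyclic (suc w)
  open Doubling w (suc w) (n<1+n w)

long-cases : ∀ {w δ} → w < δ → δ < 4 + w → δ ≡ 1 + w ⊎ δ ≡ 2 + w ⊎ δ ≡ 3 + w
long-cases {zero}  {1} _ _ = inj₁ refl
long-cases {zero}  {2} _ _ = inj₂ (inj₁ refl)
long-cases {zero}  {3} _ _ = inj₂ (inj₂ refl)
long-cases {zero}  {suc (suc (suc (suc _)))} _ (s≤s (s≤s (s≤s (s≤s ()))))
long-cases {suc w} {suc δ} (s≤s w<δ) (s≤s δ<n) with long-cases w<δ δ<n
... | inj₁ eq        = inj₁ (cong suc eq)
... | inj₂ (inj₁ eq) = inj₂ (inj₁ (cong suc eq))
... | inj₂ (inj₂ eq) = inj₂ (inj₂ (cong suc eq))

module Triangles (w : ℕ) where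
  open Cyclic (4 + w)
  open Doubling w (4 + w) (m<n+m w {4} z<s) using (Long; double)

  -- The block (z, z − 1, z − 3) of ℤ_{w+4}.
  triangle : Fin (4 + w) → Triple (Fin (4 + w))
  triangle z = ⟨ z , z ⊕ (3 + w) , z ⊕ (1 + w) ⟩

  length : ∀ {z a b} → Edge (triangle z) a b → ℕ
  length (xy _ _) = 3 + w
  length (xz _ _) = 1 + w
  length (yz _ _) = 2 + w

  ⊖-triangle : ∀ {z a b} (h : Edge (triangle z) a b) → b ⊖ a ≡ length h
  ⊖-triangle {z} (xy refl refl) = ⊖-⊕ z (n<1+n (3 + w))
  ⊖-triangle {z} (xz refl refl) = ⊖-⊕ z (m<n+m (1 + w) {3} z<s)
  ⊖-triangle {z} (yz refl refl) = begin
    z ⊕ (1 + w) ⊖ (z ⊕ (3 + w))               ≡⟨ cong (_⊖ (z ⊕ (3 + w))) rotate ⟩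
    z ⊕ (3 + w) ⊕ (2 + w) ⊖ (z ⊕ (3 + w))     ≡⟨ ⊖-⊕ (z ⊕ (3 + w)) (m<n+m (2 + w) {2} z<s) ⟩
    2 + w                                     ∎
    where
    rotate : z ⊕ (1 + w) ≡ z ⊕ (3 + w) ⊕ (2 + w)
    rotate = begin
      z ⊕ (1 + w)                 ≡⟨ cong (_⊕ (1 + w)) (⊕-period z) ⟨
      z ⊕ (4 + w) ⊕ (1 + w)       ≡⟨ ⊕-assoc z (4 + w) (1 + w) ⟩
      z ⊕ (4 + w + (1 + w))       ≡⟨ cong (λ k → z ⊕ (3 + k)) (+-suc w (1 + w)) ⟨
      z ⊕ (3 + w + (2 + w))       ≡⟨ ⊕-assoc z (3 + w) (2 + w) ⟨
      z ⊕ (3 + w) ⊕ (2 + w)       ∎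

  long-length : ∀ {z a b} (h : Edge (triangle z) a b) → w < length h
  long-length (xy _ _) = m<n+m w {3} z<s
  long-length (xz _ _) = m<n+m w {1} z<s
  long-length (yz _ _) = m<n+m w {2} z<s

  cover : ∀ x {δ} → w < δ → δ < 4 + w → ∃ λ z → Edge (triangle z) x (x ⊕ δ)
  cover x w<δ δ<n with long-cases w<δ δ<n
  ... | inj₁ refl        = x , xz refl refl
  ... | inj₂ (inj₂ refl) = x , xy refl refl
  ... | inj₂ (inj₁ refl) =
    x ⊕ 1 , yz (sym (trans (⊕-assoc x 1 (3 + w)) (⊕-period x))) (sym (⊕-assoc x 1 (1 + w)))

  same-length⇒≡ : ∀ {i j a b} (h : Edge (triangle i) a b) (h′ : Edge (triangle j) a b) →
                  length h ≡ length h′ → i ≡ j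
  same-length⇒≡ (xy refl _) (xy refl _) _ = refl
  same-length⇒≡ (xz refl _) (xz refl _) _ = refl
  same-length⇒≡ (yz refl _) (yz p _)    _ = ⊕-cancelʳ (<⇒≤ (n<1+n (3 + w))) p
  same-length⇒≡ (xy _ _) (xz _ _) ()
  same-length⇒≡ (xy _ _) (yz _ _) ()
  same-length⇒≡ (xz _ _) (xy _ _) ()
  same-length⇒≡ (xz _ _) (yz _ _) ()
  same-length⇒≡ (yz _ _) (xy _ _) ()
  same-length⇒≡ (yz _ _) (xz _ _) ()

  triangle-noAscending : ∀ z → ¬ Ascending Fin._<_ (triangle z)
  triangle-noAscending zero (_ , lt) =
    <-asym (subst₂ _<_ (toℕ-⊕-< zero ≤-refl) (toℕ-⊕-< zero (m<n+m (1 + w) {3} z<s)) lt)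
           (m<n+m (1 + w) {2} z<s)
  triangle-noAscending (suc t) (lt , _) =
    <-asym (subst (suc (toℕ t) <_) (toℕ-⊕-wrap (suc t) wraps (m<n⇒m<1+n (toℕ<n t))) lt) (n<1+n (toℕ t))
    where
    wraps : suc (toℕ t) + (3 + w) ≡ 4 + w + toℕ t
    wraps = trans (sym (+-suc (toℕ t) (3 + w))) (+-comm (toℕ t) (4 + w))

  triangles : SequencedSystem Fin._<_ Long
  triangles = record
    { Block = Fin (4 + w) ; size = 4 + w ; enumeration = ↔-id _ ; block = triangle
    ; sound = λ _ h → subst (w <_) (sym (⊖-triangle h)) (long-length h)
    ; covered = λ {x} {y} long →
        let z , h = cover x long (⊖<n y x) in z , subst (Edge (triangle z) x) (⊕-⊖ x y) h
    ; unique = λ h h′ → same-length⇒≡ h h′ (trans (sym (⊖-triangle h)) (⊖-triangle h′)) }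
    ↗ triangle-noAscending

  double+4 : SequencedDTS w → SequencedDTS (4 + w + w)
  double+4 = double triangles

open Triangles using (double+4)

data Admissible : ℕ → Set where
  order0   : Admissible 0
  order1   : Admissible 1
  2w+1     : ∀ {w} → Admissible w → Admissible (suc w + w)
  2w+4     : ∀ {w} → Admissible w → Admissible (4 + w + w)

system : ∀ {v} → Admissible v → SequencedDTS v
system order0     = noBlocks λ { {()} }
system order1     = noBlocks λ { {zero} {zero} 0≢0 → 0≢0 refl }
system (2w+1 adm) = double+1 (system adm)
system (2w+4 adm) = double+4 _ (system adm)

data Halving : ℕ → Set where
  even : ∀ s → Halving (s + s)
  odd  : ∀ s → Halving (suc (s + s))

halving : ∀ q → Halving q
halving zero = even 0
halving (suc q) with halving q
... | even s = odd s
... | odd s  = subst Halving (cong suc (+-suc s s)) (even (suc s))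

admissible-3q : ∀ q → Admissible (3 * q) × Admissible (suc (3 * q))
admissible-3q = <-rec _ step
  where
  step : ∀ q → (∀ {r} → r < q → Admissible (3 * r) × Admissible (suc (3 * r))) →
         Admissible (3 * q) × Admissible (suc (3 * q))
  step q rec with halving q
  ... | even zero    = order0 , order1
  ... | even (suc s) =
          subst Admissible (6s+6 s) (2w+4 (proj₂ (rec s<q))) ,
          subst Admissible (6s+7 s) (2w+1 (proj₁ (rec 1+s<q)))
    where
    s<q : s < suc s + suc s
    s<q = s≤s (m≤m+n s (suc s))
    1+s<q : suc s < suc s + suc s
    1+s<q = s≤s (m≤n+m (suc s) s)
    6s+6 : ∀ s → 4 + suc (3 * s) + suc (3 * s) ≡ 3 * (suc s + suc s)
    6s+6 = solve-∀
    6s+7 : ∀ s → suc (3 * suc s) + 3 * suc s ≡ suc (3 * (suc s + suc s))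
    6s+7 = solve-∀
  ... | odd s =
          subst Admissible (6s+3 s) (2w+1 (proj₂ (rec s<q))) ,
          subst Admissible (6s+4 s) (2w+4 (proj₁ (rec s<q)))
    where
    s<q : s < suc (s + s)
    s<q = s≤s (m≤m+n s s)
    6s+3 : ∀ s → suc (suc (3 * s)) + suc (3 * s) ≡ 3 * suc (s + s)
    6s+3 = solve-∀
    6s+4 : ∀ s → 4 + 3 * s + 3 * s ≡ suc (3 * suc (s + s))
    6s+4 = solve-∀

v≡v%3+3[v/3] : ∀ v → v ≡ v % 3 + 3 * (v / 3)
v≡v%3+3[v/3] v = trans (m≡m%n+[m/n]*n v 3) (cong (v % 3 +_) (*-comm (v / 3) 3))

admissible : ∀ v → v % 3 ≡ 0 ⊎ v % 3 ≡ 1 → Admissible v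
admissible v v%3 = subst Admissible (sym (v≡v%3+3[v/3] v)) (by-remainder v%3)
  where
  by-remainder : v % 3 ≡ 0 ⊎ v % 3 ≡ 1 → Admissible (v % 3 + 3 * (v / 3))
  by-remainder (inj₁ eq) rewrite eq = proj₁ (admissible-3q (v / 3))
  by-remainder (inj₂ eq) rewrite eq = proj₂ (admissible-3q (v / 3))

-- Counting blocks

↔-cantor-schröder-bernstein : ∀ {A B : Set} {a b} → Fin a ↔ A → Fin b ↔ B →
  (f : A → B) → Injective _≡_ _≡_ f → (g : B → A) → Injective _≡_ _≡_ g → a ≡ b
↔-cantor-schröder-bernstein φ ψ f f-inj g g-inj =
  cantor-schröder-bernstein {f = from ψ ∘ f ∘ to φ} {g = from φ ∘ g ∘ to ψ}
    (↔-injective φ ∘ f-inj ∘ ↔-injective (↔-sym ψ))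
    (↔-injective ψ ∘ g-inj ∘ ↔-injective (↔-sym φ))
  where open Inverse

module _ {v : ℕ} where

  edge : TransitiveTriple v → Fin 3 → Fin v × Fin v
  edge t zero             = fst t , snd t
  edge t (suc zero)       = fst t , thd t
  edge t (suc (suc zero)) = snd t , thd t

  edge-≢ : ∀ t e → proj₁ (edge t e) ≢ proj₂ (edge t e)
  edge-≢ t zero             = x≢y t
  edge-≢ t (suc zero)       = x≢z t
  edge-≢ t (suc (suc zero)) = y≢z t

  edge-HasEdge : ∀ t e → uncurry (HasEdge t) (edge t e)
  edge-HasEdge t zero             = inj₁ (refl , refl)
  edge-HasEdge t (suc zero)       = inj₂ (inj₁ (refl , refl))
  edge-HasEdge t (suc (suc zero)) = inj₂ (inj₂ (refl , refl))

  HasEdge⇒edge : ∀ t {a b} → HasEdge t a b → ∃ λ e → edge t e ≡ (a , b)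
  HasEdge⇒edge t (inj₁ (refl , refl))        = zero , refl
  HasEdge⇒edge t (inj₂ (inj₁ (refl , refl))) = suc zero , refl
  HasEdge⇒edge t (inj₂ (inj₂ (refl , refl))) = suc (suc zero) , refl

  edge-injective : ∀ t → Injective _≡_ _≡_ (edge t)
  edge-injective t {zero}             {zero}             _  = refl
  edge-injective t {suc zero}         {suc zero}         _  = refl
  edge-injective t {suc (suc zero)}   {suc (suc zero)}   _  = refl
  edge-injective t {zero}             {suc zero}         eq = ⊥-elim (y≢z t (cong proj₂ eq))
  edge-injective t {suc zero}         {zero}             eq = ⊥-elim (y≢z t (cong proj₂ (sym eq)))
  edge-injective t {zero}             {suc (suc zero)}   eq = ⊥-elim (x≢y t (cong proj₁ eq))
  edge-injective t {suc (suc zero)}   {zero}             eq = ⊥-elim (x≢y t (cong proj₁ (sym eq)))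
  edge-injective t {suc zero}         {suc (suc zero)}   eq = ⊥-elim (x≢y t (cong proj₁ eq))
  edge-injective t {suc (suc zero)}   {suc zero}         eq = ⊥-elim (x≢y t (cong proj₁ (sym eq)))

module Counting {n : ℕ} (D : DTS (suc n)) where

  blockEdge : Fin (nBlocks D) × Fin 3 → Fin (suc n) × Fin (suc n)
  blockEdge (i , e) = edge (block D i) e

  blockEdge-injective : Injective _≡_ _≡_ blockEdge
  blockEdge-injective {i , e} {j , e′} eq
    with unique D _ _ i j (edge-HasEdge (block D i) e)
                          (subst (uncurry (HasEdge (block D j))) (sym eq) (edge-HasEdge (block D j) e′))
  ... | refl = cong (i ,_) (edge-injective (block D i) eq)

  -- An ordered pair (a, b) with a ≢ b is encoded as (a, punchOut b) : Fin v × Fin (v − 1).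
  encode : Fin (nBlocks D) × Fin 3 → Fin (suc n) × Fin n
  encode (i , e) = proj₁ (edge (block D i) e) , punchOut (edge-≢ (block D i) e)

  encode-injective : Injective _≡_ _≡_ encode
  encode-injective {i , e} {j , e′} eq = blockEdge-injective (pair-≡ (cong proj₁ eq) (cong proj₂ eq))
    where
    pair-≡ : ∀ {a b a′ b′} {p : a ≢ b} {p′ : a′ ≢ b′} →
             a ≡ a′ → punchOut p ≡ punchOut p′ → (a , b) ≡ (a′ , b′)
    pair-≡ {p = p} {p′} refl q = cong (_ ,_) (punchOut-injective p p′ q)

  locateEdge : ∀ a k → ∃ λ x → blockEdge x ≡ (a , punchIn a k)
  locateEdge a k =
    let i , h = covered D a (punchIn a k) (punchInᵢ≢i a k ∘ sym)
        e , eq = HasEdge⇒edge (block D i) h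
    in (i , e) , eq

  locate : Fin (suc n) × Fin n → Fin (nBlocks D) × Fin 3
  locate = proj₁ ∘ uncurry locateEdge

  blockEdge-locate : ∀ x → blockEdge (locate x) ≡ (proj₁ x , punchIn (proj₁ x) (proj₂ x))
  blockEdge-locate = proj₂ ∘ uncurry locateEdge

  locate-injective : Injective _≡_ _≡_ locate
  locate-injective {x} {x′} eq =
    punchIn-pair-injective (trans (sym (blockEdge-locate x)) (trans (cong blockEdge eq) (blockEdge-locate x′)))
    where
    punchIn-pair-injective : ∀ {a a′ k k′} → (a , punchIn a k) ≡ (a′ , punchIn a′ k′) → (a , k) ≡ (a′ , k′)
    punchIn-pair-injective eq with cong proj₁ eq
    ... | refl = cong (_ ,_) (punchIn-injective _ _ _ (cong proj₂ eq))

  count : nBlocks D * 3 ≡ suc n * n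
  count = ↔-cantor-schröder-bernstein *↔× *↔× encode encode-injective locate locate-injective

dts⇒v%3 : ∀ {v} → DTS v → v % 3 ≡ 0 ⊎ v % 3 ≡ 1
dts⇒v%3 {zero}  _ = inj₁ refl
dts⇒v%3 {suc n} D
  with euclidsLemma (suc n) n (from-yes (prime? 3)) (divides (nBlocks D) (sym (Counting.count D)))
... | inj₁ 3∣v   = inj₁ (n∣m⇒m%n≡0 (suc n) 3 3∣v)
... | inj₂ 3∣v-1 = inj₂ (%-remove-+ʳ 1 3∣v-1)

theorem2p5 : (v : ℕ) → v ≥ 3 →
    (Σ (DTS v) GoodSequencing) ⇔ (v % 3 ≡ 0 ⊎ v % 3 ≡ 1)
theorem2p5 v _ = mk⇔ (dts⇒v%3 ∘ proj₁) (SequencedDTS⇒GoodSequencing ∘ system ∘ admissible v)
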